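{- Over the class of all finite simple graphs, $Fl <_{s.d.p} T$ and $R <_{s.d.p} T$, where $Fl$ is the flow polynomial, $R$ the reliability polynomial and $T$ the Tutte polynomial.
   Context: Graphs are finite and simple. For $A\subseteq E(G)$, $k(A)$ is the number of connected components of $(V(G),A)$; $k(G)=k(E(G))$. Tutte polynomial: $T(G;x,y)=\sum_{A\subseteq E(G)}(x-1)^{k(A)-k(E)}(y-1)^{k(A)+|A|-|V(G)|}$. Flow polynomial: $Fl(G;x)=(-1)^{|E(G)|-|V(G)|+k(G)}T(G;0,1-x)$. Reliability polynomial: $R(G;p)=p^{|E(G)|-|V(G)|+k(G)}(1-p)^{|V(G)|-k(G)}T(G;1,1/p)$. $G,H$ are similar if they have the same numbers of vertices, edges and connected components. For graph polynomials $P,Q$: $P<_{s.d.p}Q$ if for all similar graphs $G,H$, $Q(G)=Q(H)$ implies $P(G)=P(H)$. -}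

module Defs where

open import Data.Nat as ℕ using (ℕ; zero; suc)
open import Data.Bool using (Bool; true; false; _∧_; _∨_; not)
open import Data.Fin as Fin using (Fin)
open import Data.Fin.Properties using (_≟_)
open import Data.List using (List; []; _∷_; length; map; allFin; filter; _++_)
open import Data.Bool.ListAction using (any; all)
open import Data.Bool using (T)
open import Relation.Nullary.Decidable using (T?)
open import Data.List.Relation.Unary.All using (All)
open import Data.List.Relation.Unary.Unique.Propositional using (Unique)
open import Data.Product using (_×_; _,_; proj₁; proj₂)
open import Relation.Nullary.Decidable using (⌊_⌋)
open import Relation.Binary.PropositionalEquality using (_≡_)
open import Data.Rational as ℚ using (ℚ; 0ℚ; 1ℚ; _+_; _*_; _-_; -_; 1/_)

-- Finite simple graphs: vertex set Fin n, edges listed as pairs (u , v)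
-- with u < v (no loops, canonical orientation), without repetitions
-- (no multi-edges).

record Graph : Set where
  field
    n       : ℕ
    edges   : List (Fin n × Fin n)
    ordered : All (λ e → proj₁ e Fin.< proj₂ e) edges
    unique  : Unique edges
open Graph public

Edge : Graph → Set
Edge G = Fin (n G) × Fin (n G)

-- all sub-lists of a list; for a repetition-free list these are exactly
-- its subsets (each subset listed once)
sublists : {A : Set} → List A → List (List A)
sublists []       = [] ∷ []
sublists (x ∷ xs) = sublists xs ++ map (x ∷_) (sublists xs)

adj : (G : Graph) → List (Edge G) → Fin (n G) → Fin (n G) → Bool
adj G A u v = any (λ e → (⌊ proj₁ e ≟ u ⌋ ∧ ⌊ proj₂ e ≟ v ⌋)
                       ∨ (⌊ proj₁ e ≟ v ⌋ ∧ ⌊ proj₂ e ≟ u ⌋)) A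

reachW : (G : Graph) → List (Edge G) → ℕ → Fin (n G) → Fin (n G) → Bool
reachW G A zero    u v = ⌊ u ≟ v ⌋
reachW G A (suc s) u v =
  reachW G A s u v ∨ any (λ w → reachW G A s u w ∧ adj G A w v) (allFin (n G))

-- u and v lie in the same connected component of (V(G), A)
-- (walks of length ≤ |V(G)| suffice)
connected : (G : Graph) → List (Edge G) → Fin (n G) → Fin (n G) → Bool
connected G A = reachW G A (n G)

-- k(A): number of connected components of (V(G), A), counted as the number
-- of vertices that are the least vertex of their component
kA : (G : Graph) → List (Edge G) → ℕ
kA G A = length (filter (λ v → T? (isLeast v)) (allFin (n G)))
  where
  isLeast : Fin (n G) → Bool
  isLeast v = all (λ u → not (⌊ u Fin.<? v ⌋ ∧ connected G A u v)) (allFin (n G))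

kG : Graph → ℕ
kG G = kA G (edges G)

nE : Graph → ℕ
nE G = length (edges G)

_^_ : ℚ → ℕ → ℚ
p ^ zero  = 1ℚ
p ^ suc m = p * (p ^ m)

sumℚ : List ℚ → ℚ
sumℚ []       = 0ℚ
sumℚ (x ∷ xs) = x + sumℚ xs

-- The polynomials, as functions on ℚ.  All exponents below are
-- non-negative integers (k(A) ≥ k(E), nullity ≥ 0, |E|-|V|+k ≥ 0,
-- |V| ≥ k), so truncated subtraction ∸ computes them exactly.

tutte : Graph → ℚ → ℚ → ℚ
tutte G x y = sumℚ (map term (sublists (edges G)))
  where
  term : List (Edge G) → ℚ
  term A = ((x - 1ℚ) ^ (kA G A ℕ.∸ kG G))
         * ((y - 1ℚ) ^ ((kA G A ℕ.+ length A) ℕ.∸ n G))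

flow : Graph → ℚ → ℚ
flow G x = ((- 1ℚ) ^ ((nE G ℕ.+ kG G) ℕ.∸ n G)) * tutte G 0ℚ (1ℚ - x)

reliability : Graph → (p : ℚ) → .{{_ : ℚ.NonZero p}} → ℚ
reliability G p = (p ^ ((nE G ℕ.+ kG G) ℕ.∸ n G))
                * ((1ℚ - p) ^ (n G ℕ.∸ kG G))
                * tutte G 1ℚ (1/ p)

-- equality of graph-polynomial values (polynomial identity, tested on the
-- infinite field ℚ, resp. on ℚ∖{0} for R)

SameT : Graph → Graph → Set
SameT G H = ∀ x y → tutte G x y ≡ tutte H x y

SameFl : Graph → Graph → Set
SameFl G H = ∀ x → flow G x ≡ flow H x

SameR : Graph → Graph → Set
SameR G H = ∀ p → .{{_ : ℚ.NonZero p}} → reliability G p ≡ reliability H p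

Similar : Graph → Graph → Set
Similar G H = (n G ≡ n H) × (nE G ≡ nE H) × (kG G ≡ kG H)

_≤sdp_ : (Graph → Graph → Set) → (Graph → Graph → Set) → Set
SameP ≤sdp SameQ = ∀ G H → Similar G H → SameQ G H → SameP G H

module Submission where

-- Both the flow polynomial and the reliability polynomial are obtained from
-- the Tutte polynomial by (i) evaluating T at a point depending only on the
-- argument and (ii) multiplying by a prefactor whose exponents are built from
-- |V(G)|, |E(G)| and k(G) alone: the nullity |E|-|V|+k and the rank |V|-k.
-- Similar graphs share these three numbers, hence share the prefactors, and
-- graphs with equal Tutte polynomials share the evaluations.

open import Defs
open import Data.Product using (_×_; _,_)
open import Relation.Binary.PropositionalEquality using (_≡_; cong; cong₂)
open import Data.Rational using (0ℚ; 1ℚ; _*_; _-_; -_; 1/_)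
open import Data.Nat using (ℕ; _+_; _∸_)

nullity : Graph → ℕ
nullity G = (nE G + kG G) ∸ n G

rank : Graph → ℕ
rank G = n G ∸ kG G

nullity-similar : ∀ G H → Similar G H → nullity G ≡ nullity H
nullity-similar G H (sameV , sameE , sameK) =
  cong₂ _∸_ (cong₂ _+_ sameE sameK) sameV

rank-similar : ∀ G H → Similar G H → rank G ≡ rank H
rank-similar G H (sameV , _ , sameK) = cong₂ _∸_ sameV sameK

flow≤sdpTutte : SameFl ≤sdp SameT
flow≤sdpTutte G H similar sameT x =
  cong₂ _*_ (cong ((- 1ℚ) ^_) (nullity-similar G H similar))
            (sameT 0ℚ (1ℚ - x))

reliability≤sdpTutte : SameR ≤sdp SameT
reliability≤sdpTutte G H similar sameT p =
  cong₂ _*_ (cong₂ _*_ (cong (p ^_) (nullity-similar G H similar))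
                       (cong ((1ℚ - p) ^_) (rank-similar G H similar)))
            (sameT 1ℚ (1/ p))

proposition7p13 : (SameFl ≤sdp SameT) × (SameR ≤sdp SameT)
proposition7p13 = flow≤sdpTutte , reliability≤sdpTutte
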